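{- The integer $2$ is a survivor, and no even positive integer other than $2$ is a survivor.
   Context: For a positive integer $n$, let $\Pi(n)$ denote the sum of the distinct prime divisors of $n$ (so $\Pi(1)=0$), and let $\mathcal{C}(n)$ denote the sum of all positive divisors of $n$ that are not prime (including $1$ and, when $n$ is not prime, $n$ itself; so $\mathcal{C}(1)=1$). Define $X(n) = \Pi(n) - \mathcal{C}(n) + n$. For $a\ge1$ let $X^{(a)}$ denote the $a$-fold iterate of $X$. A positive integer $n$ is called a survivor if $X^{(a)}(n) > 0$ for all $a \ge 1$. -}

module Defs where

open import Data.Nat using (ℕ; zero; suc; _≤_)
open import Data.Nat.Divisibility using (_∣_; _∣?_)
open import Data.Nat.Primality using (Prime; prime?)
open import Data.List using (List; filter; map; upTo)
open import Data.Nat.ListAction using (sum)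
open import Data.Integer as ℤ using (ℤ; +_; _-_; _<_)
open import Relation.Nullary using (¬?)
open import Function using (_∘_)

divisors : ℕ → List ℕ
divisors n = filter (λ d → d ∣? n) (map suc (upTo n))

Π : ℕ → ℕ
Π n = sum (filter prime? (divisors n))

𝒞 : ℕ → ℕ
𝒞 n = sum (filter (¬? ∘ prime?) (divisors n))

X : ℕ → ℤ
X n = + (Π n ℕ.+ n) - + 𝒞 n
  where import Data.Nat as ℕ

-- X extended to ℤ: X on positive integers; on non-positive inputs
-- (where X is undefined) we return the input unchanged.  This is
-- irrelevant for survivorship: the first non-positive iterate already
-- witnesses failure.
Xℤ : ℤ → ℤ
Xℤ (+ suc k) = X (suc k)
Xℤ z = z

iterate : ℕ → ℤ → ℤ
iterate zero z = z
iterate (suc a) z = Xℤ (iterate a z)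

Survivor : ℕ → Set
Survivor n = ∀ (a : ℕ) → 1 ≤ a → + 0 < iterate a (+ n)

{-# OPTIONS --safe #-}
module Submission where

-- Let n = 2m with m ≥ 2.  If m is not prime, every prime divisor j of n is
-- dominated by the non-prime divisor 2j of n (for j = 2 with m odd, by the
-- odd non-prime divisor m instead); together with n itself this gives
-- 𝒞(n) ≥ Π(n) + n, i.e. X(n) ≤ 0.  If m = p is an odd prime, then
-- X(2p) = (2 + p) − (1 + 2p) + 2p = p + 1, which is again twice a number in
-- [2, p), so strong induction on m reduces everything to m = 2, where
-- X(4) = 1 and X(1) = 0.  Finally 2 lies on the cycle 2 ↦ 3 ↦ 5 ↦ 9 ↦ 2.

open import Defs
open import Data.Nat
open import Data.Nat.Properties
open import Data.Nat.Divisibility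
open import Data.Nat.Primality
open import Data.Nat.Induction using (<-rec)
open import Data.Nat.ListAction using (sum)
open import Data.Nat.ListAction.Properties using (sum-++)
open import Data.Nat.Tactic.RingSolver using (solve-∀)
import Data.Integer as ℤ
import Data.Integer.Properties as ℤ
open import Data.List using (List; []; _∷_; filter; map; upTo; _++_)
open import Data.List.Properties using (upTo-∷ʳ; map-++)
open import Data.List.Membership.Propositional using (_∈_)
open import Data.List.Relation.Unary.Any using (here; there)
open import Data.Bool using (if_then_else_)
open import Data.Empty using (⊥-elim)
open import Data.Product using (_×_; _,_; proj₁; ∃-syntax)
open import Data.Sum using (_⊎_; inj₁; inj₂)
open import Function using (_∘_; _⇔_; Equivalence; mk⇔)
open import Level using (Level)
open import Relation.Nullary
open import Relation.Unary using (Pred; Decidable)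
open import Relation.Binary.PropositionalEquality

private
  variable
    ℓ : Level
    P : Pred ℕ ℓ
    f g : ℕ → ℕ

sumTo : ℕ → (ℕ → ℕ) → ℕ
sumTo zero    f = 0
sumTo (suc n) f = sumTo n f + f (suc n)

sumTo-cong : ∀ n → (∀ d → 1 ≤ d → d ≤ n → f d ≡ g d) → sumTo n f ≡ sumTo n g
sumTo-cong zero    f≡g = refl
sumTo-cong (suc n) f≡g =
  cong₂ _+_ (sumTo-cong n λ d 1≤d d≤n → f≡g d 1≤d (m≤n⇒m≤1+n d≤n)) (f≡g (suc n) z<s ≤-refl)

sumTo-mono-≤ : ∀ n → (∀ d → 1 ≤ d → d ≤ n → f d ≤ g d) → sumTo n f ≤ sumTo n g
sumTo-mono-≤ zero    f≤g = z≤n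
sumTo-mono-≤ (suc n) f≤g =
  +-mono-≤ (sumTo-mono-≤ n λ d 1≤d d≤n → f≤g d 1≤d (m≤n⇒m≤1+n d≤n)) (f≤g (suc n) z<s ≤-refl)

sumTo-+ : ∀ n → sumTo n (λ d → f d + g d) ≡ sumTo n f + sumTo n g
sumTo-+ {f} {g} zero    = refl
sumTo-+ {f} {g} (suc n) rewrite sumTo-+ {f} {g} n = swap (sumTo n f) (sumTo n g) (f (suc n)) (g (suc n))
  where
  swap : ∀ a b x y → a + b + (x + y) ≡ a + x + (b + y)
  swap = solve-∀

sumTo-zero : ∀ n → (∀ d → 1 ≤ d → d ≤ n → f d ≡ 0) → sumTo n f ≡ 0
sumTo-zero zero    f≡0 = refl
sumTo-zero (suc n) f≡0 =
  cong₂ _+_ (sumTo-zero n λ d 1≤d d≤n → f≡0 d 1≤d (m≤n⇒m≤1+n d≤n)) (f≡0 (suc n) z<s ≤-refl)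

sumTo-truncate : ∀ {m n} → m ≤ n → (∀ d → m < d → d ≤ n → f d ≡ 0) → sumTo n f ≡ sumTo m f
sumTo-truncate {n = zero}  z≤n _ = refl
sumTo-truncate {f} {m} {suc n} m≤1+n f≡0 with m≤n⇒m<n∨m≡n m≤1+n
... | inj₂ refl = refl
... | inj₁ m<1+n = begin
  sumTo n f + f (suc n) ≡⟨ cong₂ _+_ (sumTo-truncate (≤-pred m<1+n) λ d m<d d≤n → f≡0 d m<d (m≤n⇒m≤1+n d≤n))
                                     (f≡0 (suc n) m<1+n ≤-refl) ⟩
  sumTo m f + 0         ≡⟨ +-identityʳ _ ⟩
  sumTo m f             ∎
  where open ≡-Reasoning

sumTo-single : ∀ {a n} → 1 ≤ a → a ≤ n → (∀ d → d ≢ a → f d ≡ 0) → sumTo n f ≡ f a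
sumTo-single {f} {suc a} {n} _ a≤n f≡0 = begin
  sumTo n f              ≡⟨ sumTo-truncate a≤n (λ d a<d _ → f≡0 d (≢-sym (<⇒≢ a<d))) ⟩
  sumTo a f + f (suc a)  ≡⟨ cong (_+ f (suc a)) (sumTo-zero a λ d _ d≤a → f≡0 d (<⇒≢ (s≤s d≤a))) ⟩
  f (suc a)              ∎
  where open ≡-Reasoning

sumTo-single-≤ : ∀ {a} n → 1 ≤ a → (∀ d → d ≢ a → f d ≡ 0) → sumTo n f ≤ f a
sumTo-single-≤ {a = a} n 1≤a f≡0 with a ≤? n
... | yes a≤n = ≤-reflexive (sumTo-single 1≤a a≤n f≡0)
... | no  a≰n = ≤-trans (≤-reflexive (sumTo-zero n λ d _ d≤n → f≡0 d λ { refl → a≰n d≤n })) z≤n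

term≤sumTo : ∀ {d} n → 1 ≤ d → d ≤ n → f d ≤ sumTo n f
term≤sumTo zero (s≤s _) ()
term≤sumTo {d = d} (suc n) 1≤d d≤1+n with m≤n⇒m<n∨m≡n d≤1+n
... | inj₁ d<1+n = ≤-trans (term≤sumTo n 1≤d (≤-pred d<1+n)) (m≤m+n _ _)
... | inj₂ refl  = m≤n+m _ _

sumTo-double : ∀ m → sumTo (m + m) f ≡ sumTo m (λ j → f (j + j ∸ 1)) + sumTo m (λ j → f (j + j))
sumTo-double zero = refl
sumTo-double {f} (suc m) rewrite +-suc m m | sumTo-double {f} m =
  regroup (sumTo m λ j → f (j + j ∸ 1)) (sumTo m λ j → f (j + j)) (f (suc (m + m))) (f (suc (suc (m + m))))
  where
  regroup : ∀ a b x y → a + b + x + y ≡ a + x + (b + y)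
  regroup = solve-∀

weight : Decidable P → ℕ → ℕ
weight P? d = if does (P? d) then d else 0

weight-yes : (P? : Decidable P) → ∀ {d} → P d → weight P? d ≡ d
weight-yes P? {d} p with P? d
... | yes _  = refl
... | no  ¬p = ⊥-elim (¬p p)

weight-no : (P? : Decidable P) → ∀ {d} → ¬ P d → weight P? d ≡ 0
weight-no P? {d} ¬p with P? d
... | yes p = ⊥-elim (¬p p)
... | no  _ = refl

weight-≤ : (P? : Decidable P) → ∀ d → weight P? d ≤ d
weight-≤ P? d with P? d
... | yes _ = ≤-refl
... | no  _ = z≤n

sumTo-weight-pair : ∀ {a b n} (P? : Decidable P) → (∀ {d} → P d ⇔ (d ≡ a ⊎ d ≡ b)) → a ≢ b →
                    1 ≤ a → a ≤ n → 1 ≤ b → b ≤ n → sumTo n (weight P?) ≡ a + b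
sumTo-weight-pair {a = a} {b} {n} P? P⇔a∨b a≢b 1≤a a≤n 1≤b b≤n = begin
  sumTo n (weight P?)                                            ≡⟨ sumTo-cong n (λ d _ _ → split d) ⟩
  sumTo n (λ d → weight (_≟ a) d + weight (_≟ b) d)              ≡⟨ sumTo-+ n ⟩
  sumTo n (weight (_≟ a)) + sumTo n (weight (_≟ b))              ≡⟨ cong₂ _+_ (singleton a≤n 1≤a) (singleton b≤n 1≤b) ⟩
  a + b                                                          ∎
  where
  open ≡-Reasoning
  singleton : ∀ {c} → c ≤ n → 1 ≤ c → sumTo n (weight (_≟ c)) ≡ c
  singleton {c} c≤n 1≤c = trans (sumTo-single 1≤c c≤n λ _ → weight-no (_≟ c)) (weight-yes (_≟ c) refl)
  split : ∀ d → weight P? d ≡ weight (_≟ a) d + weight (_≟ b) d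
  split d with P? d
  ... | no ¬p = sym (cong₂ _+_ (weight-no (_≟ a) (¬p ∘ (Equivalence.from P⇔a∨b ∘ inj₁)))
                              (weight-no (_≟ b) (¬p ∘ (Equivalence.from P⇔a∨b ∘ inj₂))))
  ... | yes p with Equivalence.to P⇔a∨b p
  ...   | inj₁ refl = sym (trans (cong₂ _+_ (weight-yes (_≟ a) refl) (weight-no (_≟ b) a≢b)) (+-identityʳ a))
  ...   | inj₂ refl = sym (cong₂ _+_ (weight-no (_≟ a) (a≢b ∘ sym)) (weight-yes (_≟ b) refl))

filter-filter : ∀ {a p q} {A : Set a} {P : Pred A p} {Q : Pred A q} (P? : Decidable P) (Q? : Decidable Q) xs →
                filter Q? (filter P? xs) ≡ filter (λ x → P? x ×-dec Q? x) xs
filter-filter P? Q? []       = refl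
filter-filter P? Q? (x ∷ xs) with P? x
... | no  _ = filter-filter P? Q? xs
... | yes _ with Q? x
...   | no  _ = filter-filter P? Q? xs
...   | yes _ = cong (x ∷_) (filter-filter P? Q? xs)

sum-filter : (P? : Decidable P) → ∀ xs → sum (filter P? xs) ≡ sum (map (weight P?) xs)
sum-filter P? []       = refl
sum-filter P? (x ∷ xs) with P? x
... | no  _ = sum-filter P? xs
... | yes _ = cong (x +_) (sum-filter P? xs)

sum-map-suc-upTo : ∀ n → sum (map f (map suc (upTo n))) ≡ sumTo n f
sum-map-suc-upTo zero = refl
sum-map-suc-upTo {f} (suc n) = begin
  sum (map f (map suc (upTo (suc n))))             ≡⟨ cong (λ xs → sum (map f (map suc xs))) (sym (upTo-∷ʳ n)) ⟩
  sum (map f (map suc (upTo n ++ n ∷ [])))         ≡⟨ cong (sum ∘ map f) (map-++ suc (upTo n) (n ∷ [])) ⟩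
  sum (map f (map suc (upTo n) ++ suc n ∷ []))     ≡⟨ cong sum (map-++ f (map suc (upTo n)) (suc n ∷ [])) ⟩
  sum (map f (map suc (upTo n)) ++ f (suc n) ∷ []) ≡⟨ sum-++ (map f (map suc (upTo n))) (f (suc n) ∷ []) ⟩
  sum (map f (map suc (upTo n))) + (f (suc n) + 0) ≡⟨ cong₂ _+_ (sum-map-suc-upTo n) (+-identityʳ (f (suc n))) ⟩
  sumTo n f + f (suc n)                            ∎
  where open ≡-Reasoning

sum-filter-divisors : (P? : Decidable P) → ∀ n →
                      sum (filter P? (divisors n)) ≡ sumTo n (weight (λ d → d ∣? n ×-dec P? d))
sum-filter-divisors P? n = begin
  sum (filter P? (divisors n))
    ≡⟨ cong sum (filter-filter (_∣? n) P? (map suc (upTo n))) ⟩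
  sum (filter (λ d → d ∣? n ×-dec P? d) (map suc (upTo n)))
    ≡⟨ sum-filter _ (map suc (upTo n)) ⟩
  sum (map (weight (λ d → d ∣? n ×-dec P? d)) (map suc (upTo n)))
    ≡⟨ sum-map-suc-upTo n ⟩
  sumTo n (weight (λ d → d ∣? n ×-dec P? d))
    ∎
  where open ≡-Reasoning

primeDivisor? : ∀ n → Decidable (λ d → d ∣ n × Prime d)
primeDivisor? n d = d ∣? n ×-dec prime? d

nonPrimeDivisor? : ∀ n → Decidable (λ d → d ∣ n × ¬ Prime d)
nonPrimeDivisor? n d = d ∣? n ×-dec ¬? (prime? d)

Π-term : ℕ → ℕ → ℕ
Π-term n = weight (primeDivisor? n)

𝒞-term : ℕ → ℕ → ℕ
𝒞-term n = weight (nonPrimeDivisor? n)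

Π≡sumTo : ∀ n → Π n ≡ sumTo n (Π-term n)
Π≡sumTo = sum-filter-divisors prime?

𝒞≡sumTo : ∀ n → 𝒞 n ≡ sumTo n (𝒞-term n)
𝒞≡sumTo = sum-filter-divisors (¬? ∘ prime?)

prime⇒≥2 : ∀ {p} → Prime p → 2 ≤ p
prime⇒≥2 {p} pp = nonTrivial⇒n>1 p {{prime⇒nonTrivial pp}}

double≡2* : ∀ m → m + m ≡ 2 * m
double≡2* m = cong (m +_) (sym (+-identityʳ m))

2∣double : ∀ m → 2 ∣ m + m
2∣double m = divides m (trans (double≡2* m) (*-comm 2 m))

m∣m+m : ∀ m → m ∣ m + m
m∣m+m m = ∣m∣n⇒∣m+n ∣-refl ∣-refl

double-∣ : ∀ {d m} → d ∣ m → d + d ∣ m + m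
double-∣ {d} {m} d∣m = subst₂ _∣_ (sym (double≡2* d)) (sym (double≡2* m)) (*-monoʳ-∣ 2 d∣m)

double-¬prime : ∀ {m} → 2 ≤ m → ¬ Prime (m + m)
double-¬prime {1} (s≤s ())
double-¬prime {m@(suc (suc k))} _ = composite⇒¬prime (composite-≢ 2 2≢m+m (2∣double m))
  where
  2≢m+m : 2 ≢ m + m
  2≢m+m 2≡m+m = 0≢1+n (trans (suc-injective (suc-injective 2≡m+m)) (+-suc k (suc k)))

prime≢2⇒¬2∣ : ∀ {p} → Prime p → p ≢ 2 → ¬ 2 ∣ p
prime≢2⇒¬2∣ pp p≢2 2∣p with prime⇒irreducible pp 2∣p
... | inj₁ ()
... | inj₂ 2≡p = p≢2 (sym 2≡p)

prime∣double⇒∣ : ∀ {d m} → Prime d → d ≢ 2 → d ∣ m + m → d ∣ m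
prime∣double⇒∣ {d} {m} pd d≢2 d∣m+m with euclidsLemma 2 m pd (subst (d ∣_) (double≡2* m) d∣m+m)
... | inj₂ d∣m = d∣m
... | inj₁ d∣2 with irreducible[2] d∣2
...   | inj₁ refl = ⊥-elim (¬prime[1] pd)
...   | inj₂ d≡2  = ⊥-elim (d≢2 d≡2)

∣double∧>⇒≡double : ∀ {d m} → 1 ≤ m → d ∣ m + m → m < d → d ≡ m + m
∣double∧>⇒≡double {d} {m} 1≤m (divides zero m+m≡0) _ = ⊥-elim (<⇒≢ (≤-trans 1≤m (m≤m+n m m)) (sym m+m≡0))
∣double∧>⇒≡double {d} {m} _ (divides 1 m+m≡d+0) _ = sym (trans m+m≡d+0 (+-identityʳ d))
∣double∧>⇒≡double {d} {m} _ (divides (suc (suc q)) m+m≡) m<d = ⊥-elim (<⇒≢ m+m<q*d m+m≡)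
  where
  m+m<q*d : m + m < suc (suc q) * d
  m+m<q*d = begin-strict
    m + m                  <⟨ +-mono-< m<d m<d ⟩
    d + d                  ≤⟨ +-monoʳ-≤ d (m≤m+n d (q * d)) ⟩
    suc (suc q) * d        ∎
    where open ≤-Reasoning

∣double-prime : ∀ {p d} → Prime p → d ∣ p + p → d ≡ 1 ⊎ d ≡ 2 ⊎ d ≡ p ⊎ d ≡ p + p
∣double-prime {p} {d} pp (divides q p+p≡q*d) = by-factor (euclidsLemma q d pp (subst (p ∣_) p+p≡q*d (m∣m+m p)))
  where
  instance _ = prime⇒nonZero pp
  by-factor : p ∣ q ⊎ p ∣ d → d ≡ 1 ⊎ d ≡ 2 ⊎ d ≡ p ⊎ d ≡ p + p
  by-factor (inj₁ (divides k q≡k*p)) with irreducible[2] (*-cancelʳ-∣ {d} {2} p (divides k 2*p≡k*[d*p]))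
    where
    2*p≡k*[d*p] : 2 * p ≡ k * (d * p)
    2*p≡k*[d*p] = begin
      2 * p          ≡⟨ sym (double≡2* p) ⟩
      p + p          ≡⟨ p+p≡q*d ⟩
      q * d          ≡⟨ cong (_* d) q≡k*p ⟩
      k * p * d      ≡⟨ reassoc k p d ⟩
      k * (d * p)    ∎
      where
      open ≡-Reasoning
      reassoc : ∀ k p d → k * p * d ≡ k * (d * p)
      reassoc = solve-∀
  ... | inj₁ d≡1 = inj₁ d≡1
  ... | inj₂ d≡2 = inj₂ (inj₁ d≡2)
  by-factor (inj₂ (divides k d≡k*p)) with irreducible[2] (*-cancelʳ-∣ {k} {2} p k*p∣2*p)
    where
    k*p∣2*p : k * p ∣ 2 * p
    k*p∣2*p = subst (_∣ 2 * p) d≡k*p (divides q (trans (sym (double≡2* p)) p+p≡q*d))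
  ... | inj₁ refl = inj₂ (inj₂ (inj₁ (trans d≡k*p (+-identityʳ p))))
  ... | inj₂ refl = inj₂ (inj₂ (inj₂ (trans d≡k*p (sym (double≡2* p)))))

¬2∣⇒odd : ∀ m → ¬ 2 ∣ m → ∃[ k ] m ≡ suc (k + k)
¬2∣⇒odd zero          ¬2∣m = ⊥-elim (¬2∣m (2 ∣0))
¬2∣⇒odd (suc zero)    _    = 0 , refl
¬2∣⇒odd (suc (suc m)) ¬2∣m with ¬2∣⇒odd m (¬2∣m ∘ ∣m∣n⇒∣m+n ∣-refl)
... | k , refl = suc k , cong (suc ∘ suc) (sym (+-suc k k))

Π-double-prime : ∀ {p} → Prime p → p ≢ 2 → Π (p + p) ≡ 2 + p
Π-double-prime {p} pp p≢2 = trans (Π≡sumTo (p + p))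
  (sumTo-weight-pair (primeDivisor? (p + p)) (mk⇔ to from) (p≢2 ∘ sym) (s≤s z≤n) (≤-trans 2≤p (m≤m+n p p))
                     (<⇒≤ 2≤p) (m≤m+n p p))
  where
  2≤p : 2 ≤ p
  2≤p = prime⇒≥2 pp
  to : ∀ {d} → d ∣ p + p × Prime d → d ≡ 2 ⊎ d ≡ p
  to (d∣2p , pd) with ∣double-prime pp d∣2p
  ... | inj₁ refl                = ⊥-elim (¬prime[1] pd)
  ... | inj₂ (inj₁ d≡2)          = inj₁ d≡2
  ... | inj₂ (inj₂ (inj₁ d≡p))   = inj₂ d≡p
  ... | inj₂ (inj₂ (inj₂ refl))  = ⊥-elim (double-¬prime 2≤p pd)
  from : ∀ {d} → d ≡ 2 ⊎ d ≡ p → d ∣ p + p × Prime d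
  from (inj₁ refl) = 2∣double p , prime[2]
  from (inj₂ refl) = m∣m+m _ , pp

𝒞-double-prime : ∀ {p} → Prime p → 𝒞 (p + p) ≡ 1 + (p + p)
𝒞-double-prime {p} pp = trans (𝒞≡sumTo (p + p))
  (sumTo-weight-pair (nonPrimeDivisor? (p + p)) (mk⇔ to from) (<⇒≢ 1<p+p) ≤-refl (<⇒≤ 1<p+p) (<⇒≤ 1<p+p) ≤-refl)
  where
  1<p+p : 1 < p + p
  1<p+p = ≤-trans (prime⇒≥2 pp) (m≤m+n p p)
  to : ∀ {d} → d ∣ p + p × ¬ Prime d → d ≡ 1 ⊎ d ≡ p + p
  to (d∣2p , ¬pd) with ∣double-prime pp d∣2p
  ... | inj₁ d≡1                 = inj₁ d≡1
  ... | inj₂ (inj₁ refl)         = ⊥-elim (¬pd prime[2])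
  ... | inj₂ (inj₂ (inj₁ refl))  = ⊥-elim (¬pd pp)
  ... | inj₂ (inj₂ (inj₂ d≡2p))  = inj₂ d≡2p
  from : ∀ {d} → d ≡ 1 ⊎ d ≡ p + p → d ∣ p + p × ¬ Prime d
  from (inj₁ refl) = 1∣ (p + p) , ¬prime[1]
  from (inj₂ refl) = ∣-refl , double-¬prime (prime⇒≥2 pp)

+[m+n]-+m≡+n : ∀ m n → ℤ.+ (m + n) ℤ.- ℤ.+ m ≡ ℤ.+ n
+[m+n]-+m≡+n m n = begin
  ℤ.+ (m + n) ℤ.- ℤ.+ m ≡⟨ ℤ.[+m]-[+n]≡m⊖n (m + n) m ⟩
  (m + n) ℤ.⊖ m         ≡⟨ ℤ.⊖-≥ (m≤m+n m n) ⟩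
  ℤ.+ (m + n ∸ m)       ≡⟨ cong ℤ.+_ (m+n∸m≡n m n) ⟩
  ℤ.+ n                 ∎
  where open ≡-Reasoning

X-double-prime : ∀ {p} → Prime p → p ≢ 2 → X (p + p) ≡ ℤ.+ suc p
X-double-prime {p} pp p≢2 = begin
  ℤ.+ (Π (p + p) + (p + p)) ℤ.- ℤ.+ 𝒞 (p + p)    ≡⟨ cong₂ (λ a b → ℤ.+ (a + (p + p)) ℤ.- ℤ.+ b) (Π-double-prime pp p≢2) (𝒞-double-prime pp) ⟩
  ℤ.+ (2 + p + (p + p)) ℤ.- ℤ.+ (1 + (p + p))    ≡⟨ cong (λ a → ℤ.+ a ℤ.- ℤ.+ (1 + (p + p))) (regroup p) ⟩
  ℤ.+ (1 + (p + p) + suc p) ℤ.- ℤ.+ (1 + (p + p)) ≡⟨ +[m+n]-+m≡+n (1 + (p + p)) (suc p) ⟩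
  ℤ.+ suc p                                       ∎
  where
  open ≡-Reasoning
  regroup : ∀ p → 2 + p + (p + p) ≡ 1 + (p + p) + suc p
  regroup = solve-∀

-- The prime 2 has no partner 4 among the divisors of 2m when m is odd.
unpaired? : ∀ m → Decidable (λ j → j ≡ 2 × ¬ 2 ∣ m)
unpaired? m j = j ≟ 2 ×-dec ¬? (2 ∣? m)

unpaired : ℕ → ℕ → ℕ
unpaired m = weight (unpaired? m)

Π-term≤𝒞-term-double : ∀ m j → Π-term (m + m) j ≤ 𝒞-term (m + m) (j + j) + unpaired m j
Π-term≤𝒞-term-double m j with primeDivisor? (m + m) j
... | no ¬[j∣n×pj] = ≤-trans (≤-reflexive (weight-no (primeDivisor? (m + m)) ¬[j∣n×pj])) z≤n
... | yes (j∣n , pj) =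
  ≤-trans (≤-reflexive (weight-yes (primeDivisor? (m + m)) (j∣n , pj))) (paired (j ≟ 2) (2 ∣? m))
  where
  doubled-term : j + j ∣ m + m → 𝒞-term (m + m) (j + j) ≡ j + j
  doubled-term 2j∣n = weight-yes (nonPrimeDivisor? (m + m)) (2j∣n , double-¬prime (prime⇒≥2 pj))
  paired : Dec (j ≡ 2) → Dec (2 ∣ m) → j ≤ 𝒞-term (m + m) (j + j) + unpaired m j
  paired (no j≢2) _ = begin
    j                                          ≤⟨ m≤m+n j j ⟩
    j + j                                      ≡⟨ sym (doubled-term (double-∣ (prime∣double⇒∣ {m = m} pj j≢2 j∣n))) ⟩
    𝒞-term (m + m) (j + j)                     ≤⟨ m≤m+n _ _ ⟩
    𝒞-term (m + m) (j + j) + unpaired m j      ∎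
    where open ≤-Reasoning
  paired (yes refl) (yes 2∣m) = begin
    2                                          ≤⟨ m≤m+n 2 2 ⟩
    4                                          ≡⟨ sym (doubled-term (double-∣ 2∣m)) ⟩
    𝒞-term (m + m) 4                           ≤⟨ m≤m+n _ _ ⟩
    𝒞-term (m + m) 4 + unpaired m 2            ∎
    where open ≤-Reasoning
  paired (yes refl) (no ¬2∣m) =
    ≤-trans (≤-reflexive (sym (weight-yes (unpaired? m) {2} (refl , ¬2∣m)))) (m≤n+m _ _)

unpaired≤odd-𝒞-terms : ∀ {m} → 2 ≤ m → ¬ Prime m → unpaired m 2 ≤ sumTo m (λ j → 𝒞-term (m + m) (j + j ∸ 1))
unpaired≤odd-𝒞-terms {m} m≥2 ¬pm with 2 ∣? m
... | yes 2∣m = ≤-trans (≤-reflexive (weight-no (unpaired? m) {2} λ (_ , ¬2∣m) → ¬2∣m 2∣m)) z≤n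
... | no ¬2∣m with ¬2∣⇒odd m ¬2∣m
...   | k , refl = begin
  unpaired m 2                                ≤⟨ weight-≤ (unpaired? m) 2 ⟩
  2                                           ≤⟨ m≥2 ⟩
  m                                           ≡⟨ sym (weight-yes (nonPrimeDivisor? (m + m)) (m∣m+m _ , ¬pm)) ⟩
  𝒞-term (m + m) m                             ≡⟨ cong (𝒞-term (m + m)) (sym (+-suc k k)) ⟩
  𝒞-term (m + m) (suc k + suc k ∸ 1)           ≤⟨ term≤sumTo m (s≤s z≤n) (s≤s (m≤m+n k k)) ⟩
  sumTo m (λ j → 𝒞-term (m + m) (j + j ∸ 1))   ∎
  where open ≤-Reasoning

Π-term-double-vanishes : ∀ {m d} → 2 ≤ m → ¬ Prime m → m ≤ d → Π-term (m + m) d ≡ 0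
Π-term-double-vanishes {m} {d} m≥2 ¬pm m≤d =
  weight-no (primeDivisor? (m + m)) λ (d∣n , pd) → by-position (m≤n⇒m<n∨m≡n m≤d) d∣n pd
  where
  by-position : m < d ⊎ m ≡ d → d ∣ m + m → ¬ Prime d
  by-position (inj₂ refl) _   = ¬pm
  by-position (inj₁ m<d) d∣n  rewrite ∣double∧>⇒≡double (≤-trans (s≤s z≤n) m≥2) d∣n m<d = double-¬prime m≥2

Π+n≤𝒞-double : ∀ {m} → 2 ≤ m → ¬ Prime m → Π (m + m) + (m + m) ≤ 𝒞 (m + m)
Π+n≤𝒞-double {m@(suc m′)} m≥2 ¬pm = begin
  Π n + n                                           ≡⟨ cong (_+ n) (trans (Π≡sumTo n) (sumTo-truncate m′≤n beyond-m′)) ⟩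
  sumTo m′ (Π-term n) + n                           ≤⟨ +-monoˡ-≤ n (sumTo-mono-≤ m′ λ j _ _ → Π-term≤𝒞-term-double m j) ⟩
  sumTo m′ (λ j → even j + unpaired m j) + n        ≡⟨ cong (_+ n) (sumTo-+ m′) ⟩
  sumTo m′ even + sumTo m′ (unpaired m) + n         ≤⟨ +-monoˡ-≤ n (+-monoʳ-≤ (sumTo m′ even) unpaired-bound) ⟩
  sumTo m′ even + sumTo m odd + n                   ≡⟨ regroup (sumTo m′ even) (sumTo m odd) n ⟩
  sumTo m odd + (sumTo m′ even + n)                 ≡⟨ cong (λ x → sumTo m odd + (sumTo m′ even + x)) n≡even-m ⟩
  sumTo m odd + sumTo m even                        ≡⟨ sym (trans (𝒞≡sumTo n) (sumTo-double m)) ⟩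
  𝒞 n                                               ∎
  where
  open ≤-Reasoning
  n = m + m
  even odd : ℕ → ℕ
  even j = 𝒞-term n (j + j)
  odd j = 𝒞-term n (j + j ∸ 1)
  m′≤n : m′ ≤ n
  m′≤n = m≤n⇒m≤1+n (m≤m+n m′ m)
  beyond-m′ : ∀ d → m′ < d → d ≤ n → Π-term n d ≡ 0
  beyond-m′ d m′<d _ = Π-term-double-vanishes m≥2 ¬pm m′<d
  unpaired-bound : sumTo m′ (unpaired m) ≤ sumTo m odd
  unpaired-bound = ≤-trans (sumTo-single-≤ m′ (s≤s z≤n) λ d d≢2 → weight-no (unpaired? m) (d≢2 ∘ proj₁))
                           (unpaired≤odd-𝒞-terms m≥2 ¬pm)
  n≡even-m : n ≡ even m
  n≡even-m = sym (weight-yes (nonPrimeDivisor? n) (∣-refl , double-¬prime m≥2))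
  regroup : ∀ a b x → a + b + x ≡ b + (a + x)
  regroup = solve-∀

X-double-nonpositive : ∀ {m} → 2 ≤ m → ¬ Prime m → X (m + m) ℤ.≤ ℤ.0ℤ
X-double-nonpositive m≥2 ¬pm = ℤ.i≤j⇒i-j≤0 (ℤ.+≤+ (Π+n≤𝒞-double m≥2 ¬pm))

iterate-suc : ∀ a z → iterate (suc a) z ≡ iterate a (Xℤ z)
iterate-suc zero    z = refl
iterate-suc (suc a) z = cong Xℤ (iterate-suc a z)

survivor-X : ∀ {n k} → Survivor n → Xℤ (ℤ.+ n) ≡ ℤ.+ k → Survivor k
survivor-X {n} S Xn≡k a _ =
  subst (ℤ.0ℤ ℤ.<_) (trans (iterate-suc a (ℤ.+ n)) (cong (iterate a) Xn≡k)) (S (suc a) (s≤s z≤n))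

¬survivor-double : ∀ m → 2 ≤ m → ¬ Survivor (m + m)
¬survivor-double = <-rec (λ m → 2 ≤ m → ¬ Survivor (m + m)) step
  where
  step : ∀ m → (∀ {h} → h < m → 2 ≤ h → ¬ Survivor (h + h)) → 2 ≤ m → ¬ Survivor (m + m)
  step 1 _ (s≤s ())
  step 2 _ _ S = ℤ.<-irrefl refl (S 2 (s≤s z≤n))
  step m@(suc (suc (suc _))) rec m≥2 S with prime? m
  ... | no ¬pm = ℤ.<⇒≱ (S 1 (s≤s z≤n)) (X-double-nonpositive m≥2 ¬pm)
  ... | yes pm with ¬2∣⇒odd m (prime≢2⇒¬2∣ pm λ ())
  ...   | suc k , m≡ = rec half<m (s≤s (s≤s z≤n)) (survivor-X S X[m+m]≡)
    where
    half = suc (suc k)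
    half<m : half < m
    half<m = subst (half <_) (sym m≡) (s≤s (s≤s (m≤n+m (suc k) k)))
    X[m+m]≡ : X (m + m) ≡ ℤ.+ (half + half)
    X[m+m]≡ = trans (X-double-prime pm λ ()) (cong (ℤ.+_ ∘ suc) (trans m≡ (cong suc (sym (+-suc k (suc k))))))

orbit-of-2 : List ℤ.ℤ
orbit-of-2 = ℤ.+ 2 ∷ ℤ.+ 3 ∷ ℤ.+ 5 ∷ ℤ.+ 9 ∷ []

Xℤ-orbit-of-2 : ∀ {z} → z ∈ orbit-of-2 → Xℤ z ∈ orbit-of-2
Xℤ-orbit-of-2 (here refl)                         = there (here refl)
Xℤ-orbit-of-2 (there (here refl))                 = there (there (here refl))
Xℤ-orbit-of-2 (there (there (here refl)))         = there (there (there (here refl)))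
Xℤ-orbit-of-2 (there (there (there (here refl)))) = here refl

iterate-2∈orbit-of-2 : ∀ a → iterate a (ℤ.+ 2) ∈ orbit-of-2
iterate-2∈orbit-of-2 zero    = here refl
iterate-2∈orbit-of-2 (suc a) = Xℤ-orbit-of-2 (iterate-2∈orbit-of-2 a)

orbit-of-2-positive : ∀ {z} → z ∈ orbit-of-2 → ℤ.0ℤ ℤ.< z
orbit-of-2-positive (here refl)                         = ℤ.+<+ z<s
orbit-of-2-positive (there (here refl))                 = ℤ.+<+ z<s
orbit-of-2-positive (there (there (here refl)))         = ℤ.+<+ z<s
orbit-of-2-positive (there (there (there (here refl)))) = ℤ.+<+ z<s

survivor-2 : Survivor 2
survivor-2 a _ = orbit-of-2-positive (iterate-2∈orbit-of-2 a)

lemma4 : Survivor 2 × (∀ (n : ℕ) → 2 ∣ n → n ≢ 0 → n ≢ 2 → ¬ Survivor n)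
lemma4 = survivor-2 , even-¬survivor
  where
  even-¬survivor : ∀ n → 2 ∣ n → n ≢ 0 → n ≢ 2 → ¬ Survivor n
  even-¬survivor n (divides 0 n≡0) n≢0 _ = ⊥-elim (n≢0 n≡0)
  even-¬survivor n (divides 1 n≡2) _ n≢2 = ⊥-elim (n≢2 n≡2)
  even-¬survivor n (divides q@(suc (suc _)) n≡q*2) _ _ =
    ¬survivor-double q (s≤s (s≤s z≤n)) ∘ subst Survivor (trans n≡q*2 (trans (*-comm q 2) (sym (double≡2* q))))
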